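{- Let $\mathbb{F}$ be an arbitrary field, $n\ge1$, and for $1\le i\le n$ let $\prec_i$ be an elimination order with respect to $x_i$ on the monomials of $\mathbb{F}[x_1,\dots,x_n]$. Then for any zero dimensional ideal $I\trianglelefteq\mathbb{F}[x_1,\dots,x_n]$, the set of standard monomials of $I$ is the same for every term order if and only if it is the same for $\prec_1,\dots,\prec_n$.
   Context: An ideal $I\trianglelefteq\mathbb{F}[x_1,\dots,x_n]$ is zero dimensional if $\mathbb{F}[x_1,\dots,x_n]/I$ is a finite dimensional $\mathbb{F}$-vector space. A term order is a total order on monomials with $1$ minimal and compatible with multiplication by monomials. The leading monomial of a nonzero polynomial is its largest monomial (w.r.t. the term order) with nonzero coefficient; a standard monomial of $I$ is a monomial that is not the leading monomial of any nonzero element of $I$. A term order is an elimination order with respect to $x_i$ if $x_i$ is larger than every monomial of $\mathbb{F}[x_1,\dots,x_{i-1},x_{i+1},\dots,x_n]$. -}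

module Defs where

open import Level using (Level; _⊔_) renaming (suc to lsuc)
open import Algebra.Bundles using (CommutativeRing)
open import Data.Nat as ℕ using (ℕ; zero; _≤_)
open import Data.Fin using (Fin; zero; suc)
open import Data.Vec using (Vec; []; _∷_; replicate; zipWith; lookup)
open import Data.Vec.Properties using (≡-dec)
open import Data.List using (List; []; _∷_; _++_; map; concatMap)
open import Data.Product using (Σ; _×_; _,_; ∃)
open import Relation.Binary.Structures using (IsTotalOrder)
open import Relation.Binary.PropositionalEquality using (_≡_; _≢_)
open import Relation.Nullary using (¬_; yes; no)
open import Relation.Unary using (Pred)
open import Function.Bundles using (_⇔_)

record Field (c ℓ : Level) : Set (lsuc (c ⊔ ℓ)) where
  field
    commutativeRing : CommutativeRing c ℓ
  open CommutativeRing commutativeRing public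
  field
    1≉0   : ¬ (1# ≈ 0#)
    inv   : ∀ x → ¬ (x ≈ 0#) → ∃ λ y → (x * y) ≈ 1#

Mono : ℕ → Set
Mono n = Vec ℕ n

one : ∀ {n} → Mono n
one = replicate _ 0

_⊗_ : ∀ {n} → Mono n → Mono n → Mono n
_⊗_ = zipWith ℕ._+_

var : ∀ {n} → Fin n → Mono n
var {ℕ.suc n} zero    = 1 ∷ replicate n 0
var           (suc i) = 0 ∷ var i

record TermOrder (n : ℕ) : Set₁ where
  field
    _≼_          : Mono n → Mono n → Set
    isTotalOrder : IsTotalOrder _≡_ _≼_
    one-minimal  : ∀ m → one ≼ m
    compatible   : ∀ a b c → a ≼ b → (a ⊗ c) ≼ (b ⊗ c)

  _≺_ : Mono n → Mono n → Set
  a ≺ b = (a ≼ b) × (a ≢ b)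

IsEliminationOrder : ∀ {n} → TermOrder n → Fin n → Set
IsEliminationOrder {n} ord i =
  ∀ (m : Mono n) → lookup m i ≡ 0 → TermOrder._≺_ ord m (var i)

module Poly {c ℓ : Level} (F : Field c ℓ) (n : ℕ) where
  open Field F

  -- a polynomial is a finite formal sum of terms  c · m
  Polynomial : Set c
  Polynomial = List (Carrier × Mono n)

  coeff : Polynomial → Mono n → Carrier
  coeff []             m = 0#
  coeff ((a , m') ∷ p) m with ≡-dec ℕ._≟_ m' m
  ... | yes _ = a + coeff p m
  ... | no  _ = coeff p m

  _≈ₚ_ : Polynomial → Polynomial → Set ℓ
  p ≈ₚ q = ∀ m → coeff p m ≈ coeff q m

  0ₚ : Polynomial
  0ₚ = []

  _+ₚ_ : Polynomial → Polynomial → Polynomial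
  _+ₚ_ = _++_

  _*ₚ_ : Polynomial → Polynomial → Polynomial
  p *ₚ q = concatMap (λ { (a , m) → map (λ { (b , m') → (a * b , m ⊗ m') }) q }) p

  scale : Carrier → Polynomial → Polynomial
  scale a = map (λ { (b , m) → (a * b , m) })

  -ₚ_ : Polynomial → Polynomial
  -ₚ p = scale (- 1#) p

  linComb : List (Carrier × Polynomial) → Polynomial
  linComb []             = 0ₚ
  linComb ((a , b) ∷ cs) = scale a b +ₚ linComb cs

  record Ideal (ℓI : Level) : Set (c ⊔ ℓ ⊔ lsuc ℓI) where
    field
      _∈I      : Pred Polynomial ℓI
      ∈-resp   : ∀ {p q} → p ≈ₚ q → p ∈I → q ∈I
      0∈       : 0ₚ ∈I
      +-closed : ∀ {p q} → p ∈I → q ∈I → (p +ₚ q) ∈I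
      *-closed : ∀ r {p} → p ∈I → (r *ₚ p) ∈I

  -- F[x]/I is a finite dimensional F-vector space: finitely many
  -- classes span the quotient
  ZeroDimensional : ∀ {ℓI} → Ideal ℓI → Set (c ⊔ ℓI)
  ZeroDimensional I =
    ∃ λ (B : List Polynomial) → ∀ (f : Polynomial) →
      ∃ λ (cs : List (Carrier × Polynomial)) →
        (map (λ { (_ , b) → b }) cs ≡ B) ×
        Ideal._∈I I (f +ₚ (-ₚ linComb cs))

  IsLeadingMonomial : TermOrder n → Polynomial → Mono n → Set ℓ
  IsLeadingMonomial ord p m =
    ¬ (coeff p m ≈ 0#) ×
    (∀ m' → ¬ (coeff p m' ≈ 0#) → TermOrder._≼_ ord m' m)

  Standard : ∀ {ℓI} → TermOrder n → Ideal ℓI → Mono n → Set (c ⊔ ℓ ⊔ ℓI)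
  Standard ord I m =
    ¬ (Σ Polynomial λ p → Ideal._∈I I p × IsLeadingMonomial ord p m)

  SameStandard : ∀ {ℓI} → Ideal ℓI → TermOrder n → TermOrder n → Set (c ⊔ ℓ ⊔ ℓI)
  SameStandard I o₁ o₂ = ∀ m → Standard o₁ I m ⇔ Standard o₂ I m

module Submission where

-- Let e be one of the elimination orders.  Since all ≺ᵢ have the same standard
-- monomials, the e-normal form of a monomial u (its representative modulo I
-- supported on standard monomials) is also its ≺ᵢ-normal form, so every
-- monomial s occurring in it satisfies s ≼ᵢ u for all i.  In an elimination
-- order for xⱼ a monomial of smaller xⱼ-degree is smaller; hence s divides u,
-- and s ≼ u in every term order ≺.  Now fix any ≺.  If m is not e-standard,
-- then m minus its normal form has ≺-leading monomial m.  If m is e-standard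
-- and f ∈ I had ≺-leading monomial m, rewriting the lower terms of f into
-- normal form would give a nonzero element of I supported on e-standard
-- monomials, which is impossible.
--
-- Standard monomials are defined negatively, so the argument runs in the
-- double-negation monad.  Well-foundedness of term orders (Dickson's lemma)
-- comes from almost-full relations.

open import Defs
open import Level using (Level; _⊔_) renaming (suc to lsuc)
open import Function.Base using (_∘_; id)
open import Data.Empty using (⊥-elim)
import Data.Empty.Polymorphic as Polymorphic
open import Data.Sum as Sum using (_⊎_; inj₁; inj₂; [_,_]; map₁)
open import Data.Product using (_×_; _,_; ∃; Σ; proj₁; proj₂)
open import Data.List using (List; []; _∷_; _++_; length; map)
open import Data.List.Membership.Propositional using (_∈_)
open import Data.List.Relation.Unary.Any using (here; there)
open import Data.Nat using (ℕ; zero; suc; _≟_; _≤_; z≤n; s≤s; _<_; _∸_; _⊓_)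
open import Data.Nat.Properties
  using (≤-refl; ≤-trans; _≤?_; ≰⇒>; ≤-pred; m≤n⇒m≤1+n; <⇒≤; <-irrefl;
         m∸n+n≡m; n∸n≡0; m<n⇒0<n∸m; m⊓n≤m; m⊓n≤n; m≥n⇒m⊓n≡n)
open import Data.Vec using ([]; _∷_; head; tail; zipWith; lookup)
open import Data.Vec.Properties using (lookup-zipWith; ≡-dec)
open import Data.Fin as Fin using (Fin)
open import Data.Vec.Relation.Binary.Pointwise.Inductive using (Pointwise; []; _∷_)
open import Relation.Binary.Core using (Rel; _⇒_)
open import Relation.Binary.Definitions using (Transitive)
open import Relation.Nullary using (¬_; Dec; yes; no)
open import Relation.Nullary.Negation using (Stable; contradiction; negated-stable)
open import Relation.Nullary.Decidable using (¬¬-excluded-middle)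
open import Relation.Binary.PropositionalEquality using (_≡_; _≢_; refl; sym; trans; cong; cong₂; subst; subst₂)
open import Relation.Binary.Structures using (IsTotalOrder)
open import Function.Bundles using (_⇔_; mk⇔; Equivalence)
open import Relation.Unary using (Pred)
open import Induction.WellFounded using (WellFounded; Acc; acc)

private
  variable
    a b ℓ ℓ′ : Level
    A B : Set a
    X Y Z W : Set a

-- Almost-full relations (Vytiniotis, Coquand and Wahlstedt, "Stop when
-- you are almost-full"): an inductive, constructive form of well-quasi-orders

data AlmostFull {a ℓ} {A : Set a} : Rel A ℓ → Set (a ⊔ lsuc ℓ) where
  full  : ∀ {R} → (∀ x y → R x y) → AlmostFull R
  later : ∀ {R} → (∀ x → AlmostFull (λ y z → R y z ⊎ R x y)) → AlmostFull R

af-mono : {R S : Rel A ℓ} → R ⇒ S → AlmostFull R → AlmostFull S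
af-mono R⇒S (full f)  = full λ x y → R⇒S (f x y)
af-mono R⇒S (later f) = later λ x → af-mono (Sum.map R⇒S R⇒S) (f x)

af-comap : {R : Rel B ℓ} (f : A → B) → AlmostFull R → AlmostFull (λ x y → R (f x) (f y))
af-comap f (full g)  = full λ x y → g (f x) (f y)
af-comap f (later g) = later λ x → af-comap f (g (f x))

-- The intersection theorem, by Coquand's argument: a nullary, a unary and
-- a binary version, each used in the inductive step of the next.  The
-- relations T₁, T₂ (instead of R ∪ …) keep all recursion structural.

module _ {A : Set a} {ℓ : Level} where

  private
    pair : {P Q : Set ℓ} → X ⊎ P → X ⊎ Q → X ⊎ (P × Q)
    pair (inj₁ x) _        = inj₁ x
    pair (inj₂ _) (inj₁ x) = inj₁ x
    pair (inj₂ p) (inj₂ q) = inj₂ (p , q)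

    distrib : (X ⊎ Y) ⊎ Z → (X ⊎ Z) ⊎ (Y ⊎ W)
    distrib = [ Sum.map inj₁ inj₁ , inj₁ ∘ inj₂ ]

    regroup : ((X ⊎ Y) ⊎ Z) ⊎ W → (X ⊎ Z) ⊎ (Y ⊎ W)
    regroup = [ distrib , inj₂ ∘ inj₂ ]

    swap : (X ⊎ Y) ⊎ Z → (X ⊎ Z) ⊎ Y
    swap = [ [ inj₁ ∘ inj₁ , inj₂ ] , inj₁ ∘ inj₂ ]

  af-∪-∩₀ : {T₁ T₂ R : Rel A ℓ} {P Q : Set ℓ} →
            AlmostFull T₁ → (∀ {x y} → T₁ x y → R x y ⊎ P) →
            AlmostFull T₂ → (∀ {x y} → T₂ x y → R x y ⊎ Q) →
            AlmostFull (λ x y → R x y ⊎ (P × Q))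
  af-∪-∩₀ (full f) h₁ (full g) h₂ = full λ x y → pair (h₁ (f x y)) (h₂ (g x y))
  af-∪-∩₀ α@(full _) h₁ (later g) h₂ = later λ x → af-mono distrib
    (af-∪-∩₀ α (map₁ inj₁ ∘ h₁) (g x) [ map₁ inj₁ ∘ h₂ , map₁ inj₂ ∘ h₂ ])
  af-∪-∩₀ (later f) h₁ β h₂ = later λ x → af-mono distrib
    (af-∪-∩₀ (f x) [ map₁ inj₁ ∘ h₁ , map₁ inj₂ ∘ h₁ ] β (map₁ inj₁ ∘ h₂))

  af-∪-∩₁ : {T₁ T₂ R : Rel A ℓ} {U V : Pred A ℓ} →
            AlmostFull T₁ → (∀ {x y} → T₁ x y → R x y ⊎ U x) →
            AlmostFull T₂ → (∀ {x y} → T₂ x y → R x y ⊎ V x) →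
            AlmostFull (λ x y → R x y ⊎ (U x × V x))
  af-∪-∩₁-left : {T₁ T₂ R : Rel A ℓ} {U V : Pred A ℓ} →
            AlmostFull T₁ → (∀ {x y} → T₁ x y → R x y ⊎ U x) →
            AlmostFull T₂ → (∀ {x y} → T₂ x y → R x y ⊎ V x) →
            ∀ x → AlmostFull (λ y z → ((R y z ⊎ R x y) ⊎ (U y × V y)) ⊎ U x)
  af-∪-∩₁-right : {T₁ T₂ R : Rel A ℓ} {U V : Pred A ℓ} →
            AlmostFull T₁ → (∀ {x y} → T₁ x y → R x y ⊎ U x) →
            AlmostFull T₂ → (∀ {x y} → T₂ x y → R x y ⊎ V x) →
            ∀ x → AlmostFull (λ y z → ((R y z ⊎ R x y) ⊎ (U y × V y)) ⊎ V x)

  af-∪-∩₁ α h₁ β h₂ = later λ x → af-mono regroup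
    (af-∪-∩₀ (af-∪-∩₁-left α h₁ β h₂ x) id (af-∪-∩₁-right α h₁ β h₂ x) id)

  af-∪-∩₁-left (full f) h₁ _ _ x = full λ y z → map₁ (inj₁ ∘ inj₂) (h₁ (f x y))
  af-∪-∩₁-left (later f) h₁ β h₂ x = af-mono swap
    (af-∪-∩₁ (f x) [ map₁ (inj₁ ∘ inj₁) ∘ h₁ , inj₁ ∘ map₁ inj₂ ∘ h₁ ] β (map₁ (inj₁ ∘ inj₁) ∘ h₂))

  af-∪-∩₁-right _ _ (full g) h₂ x = full λ y z → map₁ (inj₁ ∘ inj₂) (h₂ (g x y))
  af-∪-∩₁-right α h₁ (later g) h₂ x = af-mono swap
    (af-∪-∩₁ α (map₁ (inj₁ ∘ inj₁) ∘ h₁) (g x) [ map₁ (inj₁ ∘ inj₁) ∘ h₂ , inj₁ ∘ map₁ inj₂ ∘ h₂ ])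

  af-∪-∩₂ : {T₁ T₂ R S₁ S₂ : Rel A ℓ} →
            AlmostFull T₁ → (∀ {x y} → T₁ x y → R x y ⊎ S₁ x y) →
            AlmostFull T₂ → (∀ {x y} → T₂ x y → R x y ⊎ S₂ x y) →
            AlmostFull (λ x y → R x y ⊎ (S₁ x y × S₂ x y))
  af-∪-∩₂-left : {T₁ T₂ R S₁ S₂ : Rel A ℓ} →
            AlmostFull T₁ → (∀ {x y} → T₁ x y → R x y ⊎ S₁ x y) →
            AlmostFull T₂ → (∀ {x y} → T₂ x y → R x y ⊎ S₂ x y) →
            ∀ x → AlmostFull (λ y z → ((R y z ⊎ R x y) ⊎ (S₁ y z × S₂ y z)) ⊎ S₁ x y)
  af-∪-∩₂-right : {T₁ T₂ R S₁ S₂ : Rel A ℓ} →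
            AlmostFull T₁ → (∀ {x y} → T₁ x y → R x y ⊎ S₁ x y) →
            AlmostFull T₂ → (∀ {x y} → T₂ x y → R x y ⊎ S₂ x y) →
            ∀ x → AlmostFull (λ y z → ((R y z ⊎ R x y) ⊎ (S₁ y z × S₂ y z)) ⊎ S₂ x y)

  af-∪-∩₂ α h₁ β h₂ = later λ x → af-mono regroup
    (af-∪-∩₁ (af-∪-∩₂-left α h₁ β h₂ x) id (af-∪-∩₂-right α h₁ β h₂ x) id)

  af-∪-∩₂-left (full f) h₁ _ _ x = full λ y z → map₁ (inj₁ ∘ inj₂) (h₁ (f x y))
  af-∪-∩₂-left (later f) h₁ β h₂ x = af-mono swap
    (af-∪-∩₂ (f x) [ map₁ (inj₁ ∘ inj₁) ∘ h₁ , inj₁ ∘ map₁ inj₂ ∘ h₁ ] β (map₁ (inj₁ ∘ inj₁) ∘ h₂))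

  af-∪-∩₂-right _ _ (full g) h₂ x = full λ y z → map₁ (inj₁ ∘ inj₂) (h₂ (g x y))
  af-∪-∩₂-right α h₁ (later g) h₂ x = af-mono swap
    (af-∪-∩₂ α (map₁ (inj₁ ∘ inj₁) ∘ h₁) (g x) [ map₁ (inj₁ ∘ inj₁) ∘ h₂ , inj₁ ∘ map₁ inj₂ ∘ h₂ ])

  af-∩ : {R S : Rel A ℓ} → AlmostFull R → AlmostFull S → AlmostFull (λ x y → R x y × S x y)
  af-∩ α β = af-mono [ Polymorphic.⊥-elim , id ] (af-∪-∩₂ {R = λ _ _ → Polymorphic.⊥} α inj₂ β inj₂)

af-≥-or-≤ : ∀ k → AlmostFull (λ y z → k ≤ y ⊎ y ≤ z)
af-≥-or-≤ zero    = full λ _ _ → inj₁ z≤n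
af-≥-or-≤ (suc k) = later bound
  where
  bound : ∀ x → AlmostFull (λ y z → (suc k ≤ y ⊎ y ≤ z) ⊎ (suc k ≤ x ⊎ x ≤ y))
  bound x with suc k ≤? x
  ... | yes k<x = full λ _ _ → inj₂ (inj₁ k<x)
  ... | no  k≮x = af-mono [ inj₂ ∘ inj₂ ∘ ≤-trans (≤-pred (≰⇒> k≮x)) , inj₁ ∘ inj₂ ] (af-≥-or-≤ k)

af-≤ : AlmostFull _≤_
af-≤ = later λ x → af-mono [ inj₂ , inj₁ ] (af-≥-or-≤ x)

af-pointwise : {A : Set ℓ} {R : Rel A ℓ} → AlmostFull R → ∀ n → AlmostFull (Pointwise R {n} {n})
af-pointwise α zero    = full λ { [] [] → [] }
af-pointwise α (suc n) = af-mono (λ { {_ ∷ _} {_ ∷ _} (p , ps) → p ∷ ps })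
  (af-∩ (af-comap head α) (af-comap tail (af-pointwise α n)))

af⇒wellFounded : {T : Rel A ℓ} {_<_ : Rel A ℓ′} → AlmostFull T → Transitive _<_ →
                 (∀ {x y} → y < x → ¬ T x y) → WellFounded _<_
af⇒wellFounded (full f) _ disjoint x = acc λ y<x → ⊥-elim (disjoint y<x (f _ _))
af⇒wellFounded {T = T} {_<_ = _<_} (later f) <-trans disjoint x =
  acc λ y<x → below y<x (af⇒wellFounded (f x) <ₓ-trans disjointₓ _)
  where
  _<ₓ_ : Rel _ _
  u <ₓ v = u < v × v < x
  <ₓ-trans : Transitive _<ₓ_
  <ₓ-trans (u<v , _) (v<w , w<x) = <-trans u<v v<w , w<x
  disjointₓ : ∀ {u v} → v <ₓ u → ¬ (T u v ⊎ T x u)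
  disjointₓ (v<u , _)   (inj₁ t) = disjoint v<u t
  disjointₓ (_   , u<x) (inj₂ t) = disjoint u<x t
  below : ∀ {y} → y < x → Acc _<ₓ_ y → Acc _<_ y
  below y<x (acc rs) = acc λ z<y → below (<-trans z<y y<x) (rs (z<y , y<x))

-- Monomials and term orders

module _ {n : ℕ} where

  infix 4 _∣_
  _∣_ : Mono n → Mono n → Set
  _∣_ = Pointwise _≤_

  _/ₘ_ : Mono n → Mono n → Mono n
  _/ₘ_ = zipWith _∸_

  _≟ₘ_ : (s t : Mono n) → Dec (s ≡ t)
  _≟ₘ_ = ≡-dec _≟_

  gcdₘ : Mono n → Mono n → Mono n
  gcdₘ = zipWith _⊓_

⊗-identityˡ : ∀ {n} (m : Mono n) → one ⊗ m ≡ m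
⊗-identityˡ []      = refl
⊗-identityˡ (_ ∷ m) = cong (_ ∷_) (⊗-identityˡ m)

/ₘ-⊗ : ∀ {n} {s u : Mono n} → s ∣ u → (u /ₘ s) ⊗ s ≡ u
/ₘ-⊗ []       = refl
/ₘ-⊗ (p ∷ ps) = cong₂ _∷_ (m∸n+n≡m p) (/ₘ-⊗ ps)

gcdₘ-∣ˡ : ∀ {n} (s u : Mono n) → gcdₘ s u ∣ s
gcdₘ-∣ˡ []      []      = []
gcdₘ-∣ˡ (x ∷ s) (y ∷ u) = m⊓n≤m x y ∷ gcdₘ-∣ˡ s u

gcdₘ-∣ʳ : ∀ {n} (s u : Mono n) → gcdₘ s u ∣ u
gcdₘ-∣ʳ []      []      = []
gcdₘ-∣ʳ (x ∷ s) (y ∷ u) = m⊓n≤n x y ∷ gcdₘ-∣ʳ s u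

var-∣ : ∀ {n} (j : Fin n) {m : Mono n} → 1 ≤ lookup m j → var j ∣ m
var-∣ Fin.zero    {_ ∷ m} p = p ∷ one-∣ m
  where
  one-∣ : ∀ {k} (m : Mono k) → one ∣ m
  one-∣ []      = []
  one-∣ (_ ∷ m) = z≤n ∷ one-∣ m
var-∣ (Fin.suc j) {_ ∷ m} p = z≤n ∷ var-∣ j p

∣-or-exceeds : ∀ {n} (s u : Mono n) → s ∣ u ⊎ ∃ λ j → lookup u j < lookup s j
∣-or-exceeds []      []      = inj₁ []
∣-or-exceeds (x ∷ s) (y ∷ u) with x ≤? y | ∣-or-exceeds s u
... | no  x≰y | _              = inj₂ (Fin.zero , ≰⇒> x≰y)
... | yes x≤y | inj₁ s∣u       = inj₁ (x≤y ∷ s∣u)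
... | yes _   | inj₂ (j , u<s) = inj₂ (Fin.suc j , u<s)

module TermOrderProperties {n : ℕ} (o : TermOrder n) where

  open TermOrder o public
  open IsTotalOrder isTotalOrder public
    using (antisym; total) renaming (refl to ≼-refl; trans to ≼-trans)

  ∣⇒≼ : ∀ {s u} → s ∣ u → s ≼ u
  ∣⇒≼ {s} {u} s∣u = subst₂ _≼_ (⊗-identityˡ s) (/ₘ-⊗ s∣u)
    (compatible one (u /ₘ s) s (one-minimal (u /ₘ s)))

  ≼-≺-trans : ∀ {s t u} → s ≼ t → t ≺ u → s ≺ u
  ≼-≺-trans s≼t (t≼u , t≢u) = ≼-trans s≼t t≼u , λ { refl → t≢u (antisym t≼u s≼t) }

  ≺-trans : ∀ {s t u} → s ≺ t → t ≺ u → s ≺ u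
  ≺-trans (s≼t , _) = ≼-≺-trans s≼t

  ≺-wellFounded : WellFounded _≺_
  ≺-wellFounded = af⇒wellFounded (af-pointwise af-≤ n) ≺-trans
    λ (t≼s , t≢s) s∣t → t≢s (antisym t≼s (∣⇒≼ s∣t))

  ≼-stable : ∀ {s u} → Stable (s ≼ u)
  ≼-stable {s} {u} ¬¬s≼u with total s u
  ... | inj₁ s≼u = s≼u
  ... | inj₂ u≼s with s ≟ₘ u
  ...   | yes refl = u≼s
  ...   | no  s≢u  = contradiction (λ s≼u → s≢u (antisym s≼u u≼s)) ¬¬s≼u

module _ {n : ℕ} where

  elimination-≺ : (o : TermOrder n) {j : Fin n} → IsEliminationOrder o j →
                  ∀ {s u} → lookup u j < lookup s j → TermOrder._≺_ o u s
  elimination-≺ o {j} isElim {s} {u} u<s =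
    subst₂ _≼_ (/ₘ-⊗ (gcdₘ-∣ʳ s u)) (/ₘ-⊗ (gcdₘ-∣ˡ s u)) (compatible u′ s′ g u′≼s′) ,
    λ u≡s → <-irrefl (cong (λ m → lookup m j) u≡s) u<s
    where
    open TermOrderProperties o
    g  = gcdₘ s u
    u′ = u /ₘ g
    s′ = s /ₘ g
    g-at-j : lookup g j ≡ lookup u j
    g-at-j = trans (lookup-zipWith _⊓_ j s u) (m≥n⇒m⊓n≡n (<⇒≤ u<s))
    u′-free-of-j : lookup u′ j ≡ 0
    u′-free-of-j = trans (lookup-zipWith _∸_ j u g) (trans (cong (lookup u j ∸_) g-at-j) (n∸n≡0 (lookup u j)))
    s′-has-j : 1 ≤ lookup s′ j
    s′-has-j = subst (1 ≤_) (sym (trans (lookup-zipWith _∸_ j s g) (cong (lookup s j ∸_) g-at-j)))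
                 (m<n⇒0<n∸m u<s)
    u′≼s′ : u′ ≼ s′
    u′≼s′ = ≼-trans (proj₁ (isElim u′ u′-free-of-j)) (∣⇒≼ (var-∣ j s′-has-j))

  ≼-in-elimination-orders⇒∣ : (elim : Fin n → TermOrder n) → (∀ i → IsEliminationOrder (elim i) i) →
                              ∀ {s u} → (∀ i → TermOrder._≼_ (elim i) s u) → s ∣ u
  ≼-in-elimination-orders⇒∣ elim isElim {s} {u} s≼u with ∣-or-exceeds s u
  ... | inj₁ s∣u      = s∣u
  ... | inj₂ (j , u<s) =
    let (u≼s , u≢s) = elimination-≺ (elim j) (isElim j) u<s
    in  ⊥-elim (u≢s (TermOrderProperties.antisym (elim j) u≼s (s≼u j)))

-- The double-negation monad

module _ {a b} {A : Set a} {B : Set b} where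

  infixl 1 _>>=_
  _>>=_ : ¬ ¬ A → (A → ¬ ¬ B) → ¬ ¬ B
  ¬¬a >>= f = λ ¬b → ¬¬a (λ a → f a ¬b)

return : ∀ {a} {A : Set a} → A → ¬ ¬ A
return a ¬a = ¬a a

¬¬-Π-Fin : ∀ {a m} {P : Fin m → Set a} → (∀ i → ¬ ¬ P i) → ¬ ¬ (∀ i → P i)
¬¬-Π-Fin {m = zero}  _   = return λ ()
¬¬-Π-Fin {m = suc m} ¬¬P = do
  p₀ ← ¬¬P Fin.zero
  ps ← ¬¬-Π-Fin (¬¬P ∘ Fin.suc)
  return λ { Fin.zero → p₀ ; (Fin.suc i) → ps i }

-- Polynomials modulo an ideal

module PolynomialProperties {c ℓ} (F : Field c ℓ) (n : ℕ) where

  open Field F hiding (refl; sym; trans)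
  open Field F using () renaming (refl to ≈-refl; sym to ≈-sym; trans to ≈-trans)
  open Poly F n
  open import Algebra.Properties.Ring ring
  open import Algebra.Properties.CommutativeSemigroup +-commutativeSemigroup using (interchange)
  open import Relation.Binary.Reasoning.Setoid setoid

  infixl 6 _-ₚ_
  _-ₚ_ : Polynomial → Polynomial → Polynomial
  p -ₚ q = p +ₚ (-ₚ q)

  term : Carrier → Mono n → Polynomial
  term a t = (a , t) ∷ []

  mono : Mono n → Polynomial
  mono = term 1#

  coeff-∷-≡ : ∀ a t p → coeff ((a , t) ∷ p) t ≈ a + coeff p t
  coeff-∷-≡ a t p with t ≟ₘ t
  ... | yes _   = ≈-refl
  ... | no  t≢t = contradiction refl t≢t

  coeff-∷-≢ : ∀ a {t m} p → t ≢ m → coeff ((a , t) ∷ p) m ≈ coeff p m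
  coeff-∷-≢ a {t} {m} p t≢m with t ≟ₘ m
  ... | yes t≡m = contradiction t≡m t≢m
  ... | no  _   = ≈-refl

  coeff-term-≡ : ∀ a t → coeff (term a t) t ≈ a
  coeff-term-≡ a t = ≈-trans (coeff-∷-≡ a t []) (+-identityʳ a)

  coeff-term-≢ : ∀ a {t m} → t ≢ m → coeff (term a t) m ≈ 0#
  coeff-term-≢ a = coeff-∷-≢ a []

  coeff-++ : ∀ p q m → coeff (p ++ q) m ≈ coeff p m + coeff q m
  coeff-++ []             q m = ≈-sym (+-identityˡ _)
  coeff-++ ((a , t) ∷ p) q m with t ≟ₘ m
  ... | yes _ = ≈-trans (+-congˡ (coeff-++ p q m)) (≈-sym (+-assoc _ _ _))
  ... | no  _ = coeff-++ p q m

  coeff-scale : ∀ a p m → coeff (scale a p) m ≈ a * coeff p m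
  coeff-scale a []             m = ≈-sym (zeroʳ a)
  coeff-scale a ((b , t) ∷ p) m with t ≟ₘ m
  ... | yes _ = ≈-trans (+-congˡ (coeff-scale a p m)) (≈-sym (distribˡ a b _))
  ... | no  _ = coeff-scale a p m

  coeff-neg : ∀ p m → coeff (-ₚ p) m ≈ - coeff p m
  coeff-neg p m = ≈-trans (coeff-scale (- 1#) p m) (-1*x≈-x _)

  coeff-- : ∀ p q m → coeff (p -ₚ q) m ≈ coeff p m - coeff q m
  coeff-- p q m = ≈-trans (coeff-++ p (-ₚ q) m) (+-congˡ (coeff-neg q m))

  *ₚ-term-one : ∀ a q → (term a one *ₚ q) ≈ₚ scale a q
  *ₚ-term-one a []             m = ≈-refl
  *ₚ-term-one a ((b , t) ∷ q) m rewrite ⊗-identityˡ t with t ≟ₘ m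
  ... | yes _ = +-congˡ (*ₚ-term-one a q m)
  ... | no  _ = *ₚ-term-one a q m

  term-cong : ∀ {a b} t → a ≈ b → term a t ≈ₚ term b t
  term-cong t a≈b m with t ≟ₘ m
  ... | yes _ = +-congʳ a≈b
  ... | no  _ = ≈-refl

  term-null : ∀ {a} t → a ≈ 0# → ∀ m → coeff (term a t) m ≈ 0#
  term-null {a} t a≈0 m with t ≟ₘ m
  ... | yes _ = ≈-trans (+-identityʳ a) a≈0
  ... | no  _ = ≈-refl

  x-[x-y]≈y : ∀ x y → x - (x - y) ≈ y
  x-[x-y]≈y x y = begin
    x - (x - y)   ≈⟨ +-congˡ (⁻¹-anti-homo‿- x y) ⟩
    x + (y - x)   ≈⟨ ≈-sym (+-assoc x y (- x)) ⟩
    x + y - x     ≈⟨ xyx⁻¹≈y x y ⟩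
    y             ∎

  [x-y]+[y-z]≈x-z : ∀ x y z → (x - y) + (y - z) ≈ x - z
  [x-y]+[y-z]≈x-z x y z = begin
    (x - y) + (y - z)   ≈⟨ +-assoc x (- y) (y - z) ⟩
    x + (- y + (y - z)) ≈⟨ +-congˡ (≈-sym (+-assoc (- y) y (- z))) ⟩
    x + ((- y + y) - z) ≈⟨ +-congˡ (+-congʳ (-‿inverseˡ y)) ⟩
    x + (0# - z)        ≈⟨ +-congˡ (+-identityˡ (- z)) ⟩
    x - z               ∎

  [x+y]-[z+w]≈[x-z]+[y-w] : ∀ x y z w → (x + y) - (z + w) ≈ (x - z) + (y - w)
  [x+y]-[z+w]≈[x-z]+[y-w] x y z w = ≈-trans (+-congˡ (≈-sym (-‿+-comm z w))) (interchange x y (- z) (- w))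

  ≉0-+ : ∀ {x y} → x + y ≉ 0# → ¬ ¬ (x ≉ 0# ⊎ y ≉ 0#)
  ≉0-+ {x} {y} x+y≉0 = do
    no x≉0 ← ¬¬-excluded-middle
      where yes x≈0 → do
              no y≉0 ← ¬¬-excluded-middle
                where yes y≈0 → contradiction (≈-trans (+-cong x≈0 y≈0) (+-identityʳ 0#)) x+y≉0
              return (inj₂ y≉0)
    return (inj₁ x≉0)

  delete : Mono n → Polynomial → Polynomial
  delete u []            = []
  delete u ((a , t) ∷ p) with t ≟ₘ u
  ... | yes _ = delete u p
  ... | no  _ = (a , t) ∷ delete u p

  length-delete : ∀ u p → length (delete u p) ≤ length p
  length-delete u []            = z≤n
  length-delete u ((a , t) ∷ p) with t ≟ₘ u
  ... | yes _ = m≤n⇒m≤1+n (length-delete u p)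
  ... | no  _ = s≤s (length-delete u p)

  length-delete-∷ : ∀ a u p → length (delete u ((a , u) ∷ p)) ≤ length p
  length-delete-∷ a u p with u ≟ₘ u
  ... | yes _   = length-delete u p
  ... | no  u≢u = contradiction refl u≢u

  coeff-delete-≡ : ∀ u p → coeff (delete u p) u ≈ 0#
  coeff-delete-≡ u []            = ≈-refl
  coeff-delete-≡ u ((a , t) ∷ p) with t ≟ₘ u
  ... | yes _   = coeff-delete-≡ u p
  ... | no  t≢u = ≈-trans (coeff-∷-≢ a (delete u p) t≢u) (coeff-delete-≡ u p)

  coeff-delete-≢ : ∀ {u m} p → m ≢ u → coeff (delete u p) m ≈ coeff p m
  coeff-delete-≢ []            _   = ≈-refl
  coeff-delete-≢ {u} {m} ((a , t) ∷ p) m≢u with t ≟ₘ u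
  ... | yes refl = ≈-trans (coeff-delete-≢ p m≢u) (≈-sym (coeff-∷-≢ a p (m≢u ∘ sym)))
  ... | no  _ with t ≟ₘ m
  ...   | yes _ = +-congˡ (coeff-delete-≢ p m≢u)
  ...   | no  _ = coeff-delete-≢ p m≢u

  split-at : ∀ u p → p ≈ₚ ((coeff p u , u) ∷ delete u p)
  split-at u p m with u ≟ₘ m
  ... | yes refl = ≈-sym (≈-trans (+-congˡ (coeff-delete-≡ u p)) (+-identityʳ _))
  ... | no  u≢m  = ≈-sym (coeff-delete-≢ p (u≢m ∘ sym))

  record Supported {p} (P : Mono n → Set p) (r : Polynomial) : Set (ℓ ⊔ p) where
    constructor supported
    field support : ∀ s → coeff r s ≉ 0# → ¬ ¬ P s
  open Supported public

  module _ {p} {P : Mono n → Set p} where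

    supported-map : ∀ {q} {Q : Mono n → Set q} → (∀ {s} → P s → Q s) → ∀ {r} → Supported P r → Supported Q r
    supported-map P⇒Q Pr = supported λ s r≉0 → do
      Ps ← support Pr s r≉0
      return (P⇒Q Ps)

    supported-term : ∀ a {t} → P t → Supported P (term a t)
    supported-term a {t} Pt = supported support-term
      where
      support-term : ∀ s → coeff (term a t) s ≉ 0# → ¬ ¬ P s
      support-term s t≉0 with t ≟ₘ s
      ... | yes refl = return Pt
      ... | no  _    = contradiction ≈-refl t≉0

    supported-++ : ∀ {f g} → Supported P f → Supported P g → Supported P (f ++ g)
    supported-++ {f} {g} Pf Pg = supported λ s f+g≉0 → do
      inj₁ f≉0 ← ≉0-+ (f+g≉0 ∘ ≈-trans (coeff-++ f g s))
        where inj₂ g≉0 → support Pg s g≉0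
      support Pf s f≉0

    supported-scale : ∀ a {f} → Supported P f → Supported P (scale a f)
    supported-scale a {f} Pf = supported λ s af≉0 →
      support Pf s λ f≈0 → af≉0 (≈-trans (coeff-scale a f s) (≈-trans (*-congˡ f≈0) (zeroʳ a)))

    supported-- : ∀ {f g} → Supported P f → Supported P g → Supported P (f -ₚ g)
    supported-- Pf Pg = supported-++ Pf (supported-scale (- 1#) Pg)

    supported-delete : ∀ u {f} → Supported P f → Supported P (delete u f)
    supported-delete u {f} Pf = supported support-delete
      where
      support-delete : ∀ m → coeff (delete u f) m ≉ 0# → ¬ ¬ P m
      support-delete m d≉0 with m ≟ₘ u
      ... | yes refl = contradiction (coeff-delete-≡ u f) d≉0
      ... | no  m≢u  = support Pf m (d≉0 ∘ ≈-trans (coeff-delete-≢ f m≢u))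

  module LeadingMonomials (o : TermOrder n) where

    open TermOrderProperties o

    BoundsNonzero : Polynomial → List (Mono n) → Mono n → Set ℓ
    BoundsNonzero f L t = ∀ {u} → u ∈ L → coeff f u ≉ 0# → u ≼ t

    greatest-nonzero : ∀ f L → ¬ ¬ ((∀ {u} → u ∈ L → coeff f u ≈ 0#) ⊎
                                    ∃ λ t → coeff f t ≉ 0# × BoundsNonzero f L t)
    greatest-nonzero f []      = return (inj₁ λ ())
    greatest-nonzero f (v ∷ L) = do
      ih ← greatest-nonzero f L
      v? ← ¬¬-excluded-middle
      return (extend ih v?)
      where
      extend : (∀ {u} → u ∈ L → coeff f u ≈ 0#) ⊎ (∃ λ t → coeff f t ≉ 0# × BoundsNonzero f L t) →
               Dec (coeff f v ≈ 0#) →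
               (∀ {u} → u ∈ v ∷ L → coeff f u ≈ 0#) ⊎ (∃ λ t → coeff f t ≉ 0# × BoundsNonzero f (v ∷ L) t)
      extend (inj₁ zeros) (yes v≈0) = inj₁ λ { (here refl) → v≈0 ; (there u∈L) → zeros u∈L }
      extend (inj₁ zeros) (no v≉0)  =
        inj₂ (v , v≉0 , λ { (here refl) _ → ≼-refl ; (there u∈L) u≉0 → contradiction (zeros u∈L) u≉0 })
      extend (inj₂ (t , t≉0 , below)) (yes v≈0) =
        inj₂ (t , t≉0 , λ { (here refl) v≉0 → contradiction v≈0 v≉0 ; (there u∈L) → below u∈L })
      extend (inj₂ (t , t≉0 , below)) (no v≉0) with total v t
      ... | inj₁ v≼t = inj₂ (t , t≉0 , λ { (here refl) _ → v≼t ; (there u∈L) → below u∈L })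
      ... | inj₂ t≼v = inj₂ (v , v≉0 , λ { (here refl) _ → ≼-refl ; (there u∈L) u≉0 → ≼-trans (below u∈L u≉0) t≼v })

    coeff≉0⇒∈ : ∀ f {m} → coeff f m ≉ 0# → m ∈ map proj₂ f
    coeff≉0⇒∈ []            m≉0 = contradiction ≈-refl m≉0
    coeff≉0⇒∈ ((a , t) ∷ f) {m} m≉0 with t ≟ₘ m
    ... | yes refl = here refl
    ... | no  _    = there (coeff≉0⇒∈ f m≉0)

    ∃-leading : ∀ f {m} → coeff f m ≉ 0# → ¬ ¬ ∃ (IsLeadingMonomial o f)
    ∃-leading f m≉0 = do
      inj₂ (t , t≉0 , below) ← greatest-nonzero f (map proj₂ f)
        where inj₁ zeros → contradiction (zeros (coeff≉0⇒∈ f m≉0)) m≉0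
      return (t , t≉0 , λ u u≉0 → below (coeff≉0⇒∈ f u≉0) u≉0)

    leading-mono-- : ∀ {m r} → Supported (_≼ m) r → coeff r m ≈ 0# → IsLeadingMonomial o (mono m -ₚ r) m
    leading-mono-- {m} {r} r≼m rm≈0 = m≉0 , below
      where
      m≉0 : coeff (mono m -ₚ r) m ≉ 0#
      m≉0 m≈0 = 1≉0 (begin
        1#                          ≈⟨ +-identityʳ 1# ⟨
        1# + 0#                     ≈⟨ +-congˡ -0#≈0# ⟨
        1# - 0#                     ≈⟨ +-cong (coeff-term-≡ 1# m) (-‿cong rm≈0) ⟨
        coeff (mono m) m - coeff r m ≈⟨ coeff-- (mono m) r m ⟨
        coeff (mono m -ₚ r) m       ≈⟨ m≈0 ⟩
        0#                          ∎)
      below : ∀ u → coeff (mono m -ₚ r) u ≉ 0# → u ≼ m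
      below u u≉0 = by-cases (m ≟ₘ u)
        where
        by-cases : Dec (m ≡ u) → u ≼ m
        by-cases (yes refl) = ≼-refl
        by-cases (no m≢u)   = ≼-stable do
          no ru≉0 ← ¬¬-excluded-middle
            where yes ru≈0 → contradiction (begin
                    coeff (mono m -ₚ r) u         ≈⟨ coeff-- (mono m) r u ⟩
                    coeff (mono m) u - coeff r u  ≈⟨ +-cong (coeff-term-≢ 1# m≢u) (-‿cong ru≈0) ⟩
                    0# - 0#                       ≈⟨ -‿inverseʳ 0# ⟩
                    0#                            ∎) u≉0
          support r≼m u ru≉0
module Reduction {c ℓ ℓI} (F : Field c ℓ) (n : ℕ) (I : Poly.Ideal F n ℓI) where

  open Field F hiding (refl; sym; trans)
  open Field F using () renaming (refl to ≈-refl; sym to ≈-sym; trans to ≈-trans)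
  open Poly F n
  open Ideal I
  open PolynomialProperties F n
  open import Algebra.Properties.Ring ring
    using (x≈y⇒x∙y⁻¹≈ε; ⁻¹-anti-homo‿-; x[y-z]≈xy-xz; -0#≈0#)
  open import Relation.Binary.Reasoning.Setoid setoid

  infix 4 _≈ᴵ_
  record _≈ᴵ_ (f g : Polynomial) : Set ℓI where
    constructor congruent
    field difference∈I : (f -ₚ g) ∈I
  open _≈ᴵ_ public

  ∈-scale : ∀ a {p} → p ∈I → scale a p ∈I
  ∈-scale a {p} p∈I = ∈-resp (*ₚ-term-one a p) (*-closed (term a one) p∈I)

  ∈-null : ∀ {p} → (∀ m → coeff p m ≈ 0#) → p ∈I
  ∈-null p≈0 = ∈-resp (λ m → ≈-sym (p≈0 m)) 0∈

  ∈⇒≈ᴵ-- : ∀ f {p} → p ∈I → f ≈ᴵ f -ₚ p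
  ∈⇒≈ᴵ-- f {p} p∈I = congruent (∈-resp (λ m → ≈-sym (begin
    coeff (f -ₚ (f -ₚ p)) m                  ≈⟨ coeff-- f (f -ₚ p) m ⟩
    coeff f m - coeff (f -ₚ p) m             ≈⟨ +-congˡ (-‿cong (coeff-- f p m)) ⟩
    coeff f m - (coeff f m - coeff p m)      ≈⟨ x-[x-y]≈y _ _ ⟩
    coeff p m                                ∎)) p∈I)

  ∈-≈ᴵ : ∀ {f g} → f ∈I → f ≈ᴵ g → g ∈I
  ∈-≈ᴵ {f} {g} f∈I f≈g = ∈-resp (λ m → begin
    coeff (f -ₚ (f -ₚ g)) m                  ≈⟨ coeff-- f (f -ₚ g) m ⟩
    coeff f m - coeff (f -ₚ g) m             ≈⟨ +-congˡ (-‿cong (coeff-- f g m)) ⟩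
    coeff f m - (coeff f m - coeff g m)      ≈⟨ x-[x-y]≈y _ _ ⟩
    coeff g m                                ∎)
    (+-closed f∈I (∈-scale (- 1#) (difference∈I f≈g)))

  ≈ₚ⇒≈ᴵ : ∀ {f g} → f ≈ₚ g → f ≈ᴵ g
  ≈ₚ⇒≈ᴵ {f} {g} f≈g = congruent (∈-null λ m → ≈-trans (coeff-- f g m) (x≈y⇒x∙y⁻¹≈ε (f≈g m)))

  ≈ᴵ-sym : ∀ {f g} → f ≈ᴵ g → g ≈ᴵ f
  ≈ᴵ-sym {f} {g} f≈g = congruent (∈-resp (λ m → begin
    coeff (-ₚ (f -ₚ g)) m          ≈⟨ coeff-neg (f -ₚ g) m ⟩
    - coeff (f -ₚ g) m             ≈⟨ -‿cong (coeff-- f g m) ⟩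
    - (coeff f m - coeff g m)      ≈⟨ ⁻¹-anti-homo‿- _ _ ⟩
    coeff g m - coeff f m          ≈⟨ coeff-- g f m ⟨
    coeff (g -ₚ f) m               ∎)
    (∈-scale (- 1#) (difference∈I f≈g)))

  ≈ᴵ-trans : ∀ {f g h} → f ≈ᴵ g → g ≈ᴵ h → f ≈ᴵ h
  ≈ᴵ-trans {f} {g} {h} f≈g g≈h = congruent (∈-resp (λ m → begin
    coeff ((f -ₚ g) ++ (g -ₚ h)) m                     ≈⟨ coeff-++ (f -ₚ g) (g -ₚ h) m ⟩
    coeff (f -ₚ g) m + coeff (g -ₚ h) m               ≈⟨ +-cong (coeff-- f g m) (coeff-- g h m) ⟩
    (coeff f m - coeff g m) + (coeff g m - coeff h m) ≈⟨ [x-y]+[y-z]≈x-z _ _ _ ⟩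
    coeff f m - coeff h m                             ≈⟨ coeff-- f h m ⟨
    coeff (f -ₚ h) m                                  ∎)
    (+-closed (difference∈I f≈g) (difference∈I g≈h)))

  ++-cong-≈ᴵ : ∀ {f f′ g g′} → f ≈ᴵ g → f′ ≈ᴵ g′ → f ++ f′ ≈ᴵ g ++ g′
  ++-cong-≈ᴵ {f} {f′} {g} {g′} f≈g f′≈g′ = congruent (∈-resp (λ m → begin
    coeff ((f -ₚ g) ++ (f′ -ₚ g′)) m                       ≈⟨ coeff-++ (f -ₚ g) (f′ -ₚ g′) m ⟩
    coeff (f -ₚ g) m + coeff (f′ -ₚ g′) m                 ≈⟨ +-cong (coeff-- f g m) (coeff-- f′ g′ m) ⟩
    (coeff f m - coeff g m) + (coeff f′ m - coeff g′ m)   ≈⟨ [x+y]-[z+w]≈[x-z]+[y-w] _ _ _ _ ⟨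
    (coeff f m + coeff f′ m) - (coeff g m + coeff g′ m)   ≈⟨ +-cong (coeff-++ f f′ m) (-‿cong (coeff-++ g g′ m)) ⟨
    coeff (f ++ f′) m - coeff (g ++ g′) m                 ≈⟨ coeff-- (f ++ f′) (g ++ g′) m ⟨
    coeff ((f ++ f′) -ₚ (g ++ g′)) m                       ∎)
    (+-closed (difference∈I f≈g) (difference∈I f′≈g′)))

  scale-cong-≈ᴵ : ∀ a {f g} → f ≈ᴵ g → scale a f ≈ᴵ scale a g
  scale-cong-≈ᴵ a {f} {g} f≈g = congruent (∈-resp (λ m → begin
    coeff (scale a (f -ₚ g)) m                  ≈⟨ coeff-scale a (f -ₚ g) m ⟩
    a * coeff (f -ₚ g) m                        ≈⟨ *-congˡ (coeff-- f g m) ⟩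
    a * (coeff f m - coeff g m)                 ≈⟨ x[y-z]≈xy-xz a _ _ ⟩
    a * coeff f m - a * coeff g m               ≈⟨ +-cong (coeff-scale a f m) (-‿cong (coeff-scale a g m)) ⟨
    coeff (scale a f) m - coeff (scale a g) m   ≈⟨ coeff-- (scale a f) (scale a g) m ⟨
    coeff (scale a f -ₚ scale a g) m            ∎)
    (∈-scale a (difference∈I f≈g)))

  ≈ᴵ-refl : ∀ {f} → f ≈ᴵ f
  ≈ᴵ-refl = ≈ₚ⇒≈ᴵ λ _ → ≈-refl

  Reducible : ∀ {p} → (Mono n → Set p) → Polynomial → Set (c ⊔ ℓ ⊔ ℓI ⊔ p)
  Reducible P f = ¬ ¬ (Σ Polynomial λ r → Supported P r × f ≈ᴵ r)

  module _ {p} {P : Mono n → Set p} where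

    reducible-null : ∀ {f} → (∀ m → coeff f m ≈ 0#) → Reducible P f
    reducible-null f≈0 = return ([] , supported (λ _ 0≉0 → contradiction ≈-refl 0≉0) , ≈ₚ⇒≈ᴵ f≈0)

    reducible-≈ᴵ : ∀ {f g} → f ≈ᴵ g → Reducible P g → Reducible P f
    reducible-≈ᴵ f≈g Pg = do
      (r , Pr , g≈r) ← Pg
      return (r , Pr , ≈ᴵ-trans f≈g g≈r)

    reducible-++ : ∀ {f g} → Reducible P f → Reducible P g → Reducible P (f ++ g)
    reducible-++ Pf Pg = do
      (r , Pr , f≈r) ← Pf
      (r′ , Pr′ , g≈r′) ← Pg
      return (r ++ r′ , supported-++ Pr Pr′ , ++-cong-≈ᴵ f≈r g≈r′)

    reducible-scale : ∀ a {f} → Reducible P f → Reducible P (scale a f)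
    reducible-scale a Pf = do
      (r , Pr , f≈r) ← Pf
      return (scale a r , supported-scale a Pr , scale-cong-≈ᴵ a f≈r)

    reducible-term : ∀ a {u} → (a ≉ 0# → Reducible P (mono u)) → Reducible P (term a u)
    reducible-term a {u} reduce = do
      no a≉0 ← ¬¬-excluded-middle
        where yes a≈0 → reducible-null (term-null u a≈0)
      reducible-≈ᴵ (≈ₚ⇒≈ᴵ (term-cong u (≈-sym (*-identityʳ a)))) (reducible-scale a (reduce a≉0))

    reducible-sum : ∀ {q} {Q : Mono n → Set q} → (∀ {u} → Q u → Reducible P (mono u)) →
                    ∀ {f} → Supported Q f → Reducible P f
    reducible-sum {Q = Q} reduce {f} = go f (length f) ≤-refl
      where
      go : ∀ f k → length f ≤ k → Supported Q f → Reducible P f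
      go []            _       _           _  = reducible-null λ _ → ≈-refl
      go ((a , u) ∷ f) (suc k) (s≤s |f|≤k) Qg =
        reducible-≈ᴵ (≈ₚ⇒≈ᴵ (split-at u g))
          (reducible-++ (reducible-term (coeff g u) λ gu≉0 → support Qg u gu≉0 >>= reduce)
                        (go (delete u g) k (≤-trans (length-delete-∷ a u f) |f|≤k) (supported-delete u Qg)))
        where
        g = (a , u) ∷ f

  reducible-map : ∀ {p q} {P : Mono n → Set p} {Q : Mono n → Set q} → (∀ {s} → P s → Q s) →
                  ∀ {f} → Reducible P f → Reducible Q f
  reducible-map P⇒Q Pf = do
    (r , Pr , f≈r) ← Pf
    return (r , supported-map P⇒Q Pr , f≈r)

  module NormalForms (o : TermOrder n) where

    open TermOrderProperties o
    open LeadingMonomials o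

    standard-supported-∈⇒null : ∀ {p} → p ∈I → Supported (Standard o I) p → ∀ s → ¬ coeff p s ≉ 0#
    standard-supported-∈⇒null {p} p∈I std s s≉0 =
      ∃-leading p s≉0 λ (t , lead) → support std t (proj₁ lead) λ std-t → std-t (p , p∈I , lead)

    standard-representatives-agree : ∀ {r r′} → r ≈ᴵ r′ →
      Supported (Standard o I) r → Supported (Standard o I) r′ →
      ∀ s → coeff r s ≉ 0# → coeff r′ s ≉ 0#
    standard-representatives-agree {r} {r′} r≈r′ std std′ s r≉0 r′≈0 =
      standard-supported-∈⇒null (difference∈I r≈r′) (supported-- std std′) s λ d≈0 → r≉0 (begin
        coeff r s                   ≈⟨ +-identityʳ _ ⟨
        coeff r s + 0#              ≈⟨ +-congˡ -0#≈0# ⟨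
        coeff r s - 0#              ≈⟨ +-congˡ (-‿cong r′≈0) ⟨
        coeff r s - coeff r′ s      ≈⟨ coeff-- r r′ s ⟨
        coeff (r -ₚ r′) s           ≈⟨ d≈0 ⟩
        0#                          ∎)

    cancel-leading : ∀ {p t a} → IsLeadingMonomial o p t → a * coeff p t ≈ 1# →
                     Supported (_≺ t) (mono t -ₚ scale a p)
    cancel-leading {p} {t} {a} (_ , below) a·lc≈1 = supported λ u q≉0 → by-cases u q≉0 (t ≟ₘ u)
      where
      coeff-q : ∀ u → coeff (mono t -ₚ scale a p) u ≈ coeff (mono t) u - a * coeff p u
      coeff-q u = ≈-trans (coeff-- (mono t) (scale a p) u) (+-congˡ (-‿cong (coeff-scale a p u)))
      by-cases : ∀ u → coeff (mono t -ₚ scale a p) u ≉ 0# → Dec (t ≡ u) → ¬ ¬ (u ≺ t)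
      by-cases u q≉0 (yes refl) = contradiction (begin
        coeff (mono t -ₚ scale a p) t   ≈⟨ coeff-q _ ⟩
        coeff (mono t) t - a * coeff p t ≈⟨ +-cong (coeff-term-≡ 1# t) (-‿cong a·lc≈1) ⟩
        1# - 1#                         ≈⟨ -‿inverseʳ 1# ⟩
        0#                              ∎) q≉0
      by-cases u q≉0 (no t≢u) = do
        no pu≉0 ← ¬¬-excluded-middle
          where yes pu≈0 → contradiction (begin
                  coeff (mono t -ₚ scale a p) u    ≈⟨ coeff-q _ ⟩
                  coeff (mono t) u - a * coeff p u ≈⟨ +-cong (coeff-term-≢ 1# t≢u) (-‿cong (*-congˡ pu≈0)) ⟩
                  0# - a * 0#                      ≈⟨ +-congˡ (-‿cong (zeroʳ a)) ⟩
                  0# - 0#                          ≈⟨ -‿inverseʳ 0# ⟩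
                  0#                               ∎) q≉0
        return (below u pu≉0 , t≢u ∘ sym)

    reducible-to-standard : ∀ t → Reducible (λ s → Standard o I s × s ≼ t) (mono t)
    reducible-to-standard t = go t (≺-wellFounded t)
      where
      go : ∀ t → Acc _≺_ t → Reducible (λ s → Standard o I s × s ≼ t) (mono t)
      go t (acc smaller) = do
        no ¬std ← ¬¬-excluded-middle
          where yes std → return (mono t , supported-term 1# (std , ≼-refl) , ≈ᴵ-refl)
        (p , p∈I , lead@(lc≉0 , _)) ← ¬std
        let (a , lc·a≈1) = inv (coeff p t) lc≉0
        reducible-≈ᴵ (∈⇒≈ᴵ-- (mono t) (∈-scale a p∈I))
          (reducible-sum (λ u≺t → reducible-map (λ (std , s≼u) → std , ≼-trans s≼u (proj₁ u≺t))
                                                (go _ (smaller u≺t)))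
                         (cancel-leading lead (≈-trans (*-comm a (coeff p t)) lc·a≈1)))

  module _ (elim : Fin n → TermOrder n) (isElim : ∀ i → IsEliminationOrder (elim i) i)
           (e : TermOrder n) (agree : ∀ i → SameStandard I (elim i) e) where

    open NormalForms e

    ≼-in-normal-form : ∀ i {u r} → mono u ≈ᴵ r → Supported (Standard e I) r →
                       ∀ s → coeff r s ≉ 0# → ¬ ¬ TermOrder._≼_ (elim i) s u
    ≼-in-normal-form i {u} u≈r std s r≉0 = do
      (rᵢ , Prᵢ , u≈rᵢ) ← NormalForms.reducible-to-standard (elim i) u
      let stdᵢ = supported-map (λ (std-s , _) → Equivalence.to (agree i _) std-s) Prᵢ
      (_ , s≼u) ← support Prᵢ s (standard-representatives-agree (≈ᴵ-trans (≈ᴵ-sym u≈r) u≈rᵢ) std stdᵢ s r≉0)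
      return s≼u

    reducible-to-standard-divisors : ∀ u → Reducible (λ s → Standard e I s × s ∣ u) (mono u)
    reducible-to-standard-divisors u = do
      (r , Pr , u≈r) ← reducible-to-standard u
      let std = supported-map proj₁ Pr
      return (r , supported (λ s r≉0 → do
        (std-s , _) ← support Pr s r≉0
        s≼ᵢu ← ¬¬-Π-Fin λ i → ≼-in-normal-form i u≈r std s r≉0
        return (std-s , ≼-in-elimination-orders⇒∣ elim isElim s≼ᵢu)) , u≈r)

    standard⇒standard-e : ∀ o {m} → Standard o I m → Standard e I m
    standard⇒standard-e o {m} std-o = negated-stable do
      (r , Pr , m≈r) ← reducible-to-standard-divisors m
      no rm≉0 ← ¬¬-excluded-middle
        where yes rm≈0 → contradiction (mono m -ₚ r , difference∈I m≈r ,
                                        leading-mono-- (supported-map (∣⇒≼ ∘ proj₂) Pr) rm≈0) std-o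
      (std-m , _) ← support Pr m rm≉0
      return std-m
      where
      open TermOrderProperties o
      open LeadingMonomials o

    standard-e⇒standard : ∀ o {m} → Standard e I m → Standard o I m
    standard-e⇒standard o {m} std-e (f , f∈I , fm≉0 , below) =
      reducible-sum reduce-below rest-below λ (r′ , Pr′ , rest≈r′) →
        standard-supported-∈⇒null
          (∈-≈ᴵ f∈I (≈ᴵ-trans (≈ₚ⇒≈ᴵ (split-at m f)) (++-cong-≈ᴵ (≈ᴵ-refl {term lc m}) rest≈r′)))
          (supported-++ (supported-term lc std-e) (supported-map proj₁ Pr′))
          m (leading-survives Pr′)
      where
      open TermOrderProperties o
      lc = coeff f m
      rest-below : Supported (_≺ m) (delete m f)
      rest-below = supported λ u d≉0 →
        let u≢m : u ≢ m
            u≢m = λ { refl → d≉0 (coeff-delete-≡ m f) }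
        in return (below u (d≉0 ∘ ≈-trans (coeff-delete-≢ f u≢m)) , u≢m)
      reduce-below : ∀ {u} → u ≺ m → Reducible (λ s → Standard e I s × s ≺ m) (mono u)
      reduce-below u≺m = reducible-map (λ (std , s∣u) → std , ≼-≺-trans (∣⇒≼ s∣u) u≺m)
                                       (reducible-to-standard-divisors _)
      leading-survives : ∀ {r′} → Supported (λ s → Standard e I s × s ≺ m) r′ → coeff ((lc , m) ∷ r′) m ≉ 0#
      leading-survives {r′} Pr′ rm≈0 = support Pr′ m r′m≉0 λ (_ , m≺m) → proj₂ m≺m refl
        where
        r′m≉0 : coeff r′ m ≉ 0#
        r′m≉0 r′m≈0 = fm≉0 (begin
          lc                          ≈⟨ +-identityʳ lc ⟨
          lc + 0#                     ≈⟨ +-congˡ r′m≈0 ⟨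
          lc + coeff r′ m             ≈⟨ coeff-∷-≡ lc m r′ ⟨
          coeff ((lc , m) ∷ r′) m     ≈⟨ rm≈0 ⟩
          0#                          ∎)

    all-orders-agree : ∀ o₁ o₂ → SameStandard I o₁ o₂
    all-orders-agree o₁ o₂ m = mk⇔ (standard-e⇒standard o₂ ∘ standard⇒standard-e o₁)
                                   (standard-e⇒standard o₁ ∘ standard⇒standard-e o₂)

theorem6 : ∀ {c ℓ ℓI : Level} (F : Field c ℓ) (n : ℕ) → 1 ≤ n →
    (elim : Fin n → TermOrder n) → (∀ i → IsEliminationOrder (elim i) i) →
    (I : Poly.Ideal F n ℓI) → Poly.ZeroDimensional F n I →
    ((∀ (o₁ o₂ : TermOrder n) → Poly.SameStandard F n I o₁ o₂)
    ⇔ (∀ (i j : Fin n) → Poly.SameStandard F n I (elim i) (elim j)))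
theorem6 F (suc n) _ elim isElim I _ =
  mk⇔ (λ all i j → all (elim i) (elim j))
      (λ same → Reduction.all-orders-agree F (suc n) I elim isElim (elim Fin.zero) (λ i → same i Fin.zero))
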